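{- Let $A$ be a finite set, $G$ an $A$-interval graph and $T=t_A(G)$. Then: (1) each vertex of $G$ whose interval intersects the first segment is associated with a single node of $T$, and this node lies on the path starting at the root that always proceeds to the first child of the current node; (2) each vertex of $G$ whose interval intersects the last segment is associated with at most $|A|$ nodes of $T$; (3) each vertex of $G$ is associated with at most $|A|+1$ nodes of $T$; (4) each vertex of $G$ is associated with exactly one node of $T$ such that the third coordinate of its color does not contain $\leftarrow$; (5) for every edge $vv'$ of $G$ there exists a unique pair of nodes $u,u'$ of $T$, associated with $v$ and $v'$ (not necessarily in this order), such that $u$ is in the subtree of $u'$, the color of $u$ is $(x,X,Z)$, the color of $u'$ is $(x',X',Z')$, and $x'\in X$.
   Context: A semi-interval representation of a graph $G$ assigns to each vertex $v$ an interval $J_v=[k,\ell)$ with integers $k<\ell$ such that adjacent vertices have intersecting intervals (non-adjacent ones may also intersect). Segments are intervals $[k,k+1)$; the first (last) segment is the leftmost (rightmost) segment intersected by some $J_v$. An $A$-interval graph is a graph with a semi-interval representation in which each interval (vertex) is colored by an element of $A$ so that intersecting intervals get different colors. The plane tree $t_A(G)$ (rooted, ordered children), each non-root node having a color in $A\times 2^A\times 2^{\{\rightarrow,\leftarrow\}}$ and being associated with a vertex of $G$, is defined recursively on $|A|$ and $|G|$. If $G$ is empty, $t_A(G)$ is a single (root) node. Otherwise let $v$ be a vertex with a longest interval among those intersecting the first segment, $x$ its color, $A'=A\setminus\{x\}$. Let $G'$ be the $A'$-interval graph obtained by restricting $G\setminus\{v\}$ to the vertices whose intervals intersect $J_v$,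 with intervals restricted to the segments contained in $J_v$. Let $G''$ be the $A$-interval graph obtained by restricting $G$ to vertices whose intervals intersect the complement of $J_v$, with intervals restricted to segments not contained in $J_v$, and removing all edges between vertices of $G''$ that are also edges of $G'$ (so $G''$ is empty if $J_v$ meets all segments). Then $t_A(G)$ is obtained from $t_A(G'')$ by attaching $t_{A'}(G')$ so that its root becomes the first child of the root of $t_A(G'')$; this node is colored $(x,\emptyset,\emptyset)$ and associated with $v$; all other nodes keep their colors and associations from $t_{A'}(G')$ and $t_A(G'')$, except: $x$ is inserted into the second coordinate of the color of each node of $t_{A'}(G')$ associated with a vertex adjacent to $v$ and whose third coordinate does not contain $\leftarrow$; $\rightarrow$ is inserted into the third coordinate of each node of $t_{A'}(G')$ associated with a vertex in $V(G')\cap V(G'')$; and $\leftarrow$ is inserted into the third coordinate of each node of $t_A(G'')$ associated with a vertex in $V(G')\cap V(G'')$. -}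

module Defs where

open import Data.Bool using (Bool; true; false; _∧_; _∨_; not; if_then_else_)
open import Data.Nat as ℕ using (ℕ; zero; suc)
open import Data.Integer as ℤ using (ℤ; _⊔_; _⊓_; _-_; +_)
open import Data.List using (List; []; _∷_; _++_; map; length; filter)
open import Data.Bool.ListAction using (any)
open import Data.List.Membership.Propositional using (_∈_)
open import Data.List.Relation.Unary.Unique.Propositional using (Unique)
open import Data.List.Relation.Unary.All using (All)
open import Data.List.Relation.Binary.Prefix.Heterogeneous using (Prefix)
open import Data.Product using (_×_; _,_; proj₁; proj₂; Σ; ∃; ∃!; map₁)
open import Data.Sum using (_⊎_)
open import Relation.Binary.PropositionalEquality using (_≡_; _≢_)
open import Relation.Nullary.Decidable using (⌊_⌋; _×-dec_)

-- Colours are natural numbers; a finite colour set A is a duplicate-free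
-- list of naturals (|A| = length A).  Vertices are identified by a
-- natural-number name.

-- A vertex of a semi-interval representation: name, interval [lo , hi), colour.
record Vtx : Set where
  constructor vtx
  field
    name : ℕ
    lo   : ℤ
    hi   : ℤ
    col  : ℕ
open Vtx public

record IGraph : Set where
  constructor igraph
  field
    verts : List Vtx
    adj   : ℕ → ℕ → Bool
open IGraph public

Intersect : Vtx → Vtx → Set
Intersect u w = lo u ℤ.< hi w × lo w ℤ.< hi u

-- the interval of u meets the segment [k , k+1)
MeetsSegment : Vtx → ℤ → Set
MeetsSegment u k = lo u ℤ.≤ k × k ℤ.< hi u

IsFirstSegment : IGraph → ℤ → Set
IsFirstSegment G k =
  (∃ λ u → u ∈ verts G × MeetsSegment u k) ×
  (∀ {u j} → u ∈ verts G → MeetsSegment u j → k ℤ.≤ j)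

IsLastSegment : IGraph → ℤ → Set
IsLastSegment G k =
  (∃ λ u → u ∈ verts G × MeetsSegment u k) ×
  (∀ {u j} → u ∈ verts G → MeetsSegment u j → j ℤ.≤ k)

intervalLength : Vtx → ℤ
intervalLength u = hi u - lo u

record IsAIntervalGraph (A : List ℕ) (G : IGraph) : Set where
  field
    names-unique      : Unique (map name (verts G))
    interval-nonempty : ∀ {u} → u ∈ verts G → lo u ℤ.< hi u
    colour-in-A       : ∀ {u} → u ∈ verts G → col u ∈ A
    adj-sym           : ∀ {u w} → u ∈ verts G → w ∈ verts G →
                        adj G (name u) (name w) ≡ adj G (name w) (name u)
    adj-irrefl        : ∀ {u} → u ∈ verts G → adj G (name u) (name u) ≡ false
    adj⇒intersect     : ∀ {u w} → u ∈ verts G → w ∈ verts G →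
                        adj G (name u) (name w) ≡ true → Intersect u w
    intersect⇒colours-differ : ∀ {u w} → u ∈ verts G → w ∈ verts G →
                        name u ≢ name w → Intersect u w → col u ≢ col w

keep : {X : Set} → (X → Bool) → List X → List X
keep p []       = []
keep p (x ∷ xs) = if p x then x ∷ keep p xs else keep p xs

ltᵇ : ℤ → ℤ → Bool
ltᵇ a b = ⌊ a ℤ.<? b ⌋

eqᵇ : ℕ → ℕ → Bool
eqᵇ m n = ⌊ m ℕ.≟ n ⌋

intersectsᵇ : Vtx → Vtx → Bool
intersectsᵇ u w = ltᵇ (lo u) (hi w) ∧ ltᵇ (lo w) (hi u)

G′ : Vtx → IGraph → IGraph
G′ v G = igraph
  (map (λ u → record u { lo = lo u ⊔ lo v ; hi = hi u ⊓ hi v })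
       (keep (λ u → not (eqᵇ (name u) (name v)) ∧ intersectsᵇ u v) (verts G)))
  (adj G)

inG′ : Vtx → IGraph → ℕ → Bool
inG′ v G n = any (λ u → eqᵇ (name u) n) (verts (G′ v G))

-- G'' : G restricted to vertices whose interval meets the complement of
-- J_v (which, J_v starting at the first segment, lies to the right of J_v),
-- intervals restricted to segments not in J_v; edges of G' removed.
G″ : Vtx → IGraph → IGraph
G″ v G = igraph
  (map (λ u → record u { lo = lo u ⊔ hi v })
       (keep (λ u → ltᵇ (hi v) (hi u)) (verts G)))
  (λ n m → adj G n m ∧ not (inG′ v G n ∧ inG′ v G m))

inG″ : Vtx → IGraph → ℕ → Bool
inG″ v G n = any (λ u → eqᵇ (name u) n) (verts (G″ v G))

-- Plane trees.  A non-root node carries a colour (x , X , Z) with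
-- Z ⊆ {→ , ←} encoded by two Booleans, and an associated vertex (name).

record Label : Set where
  constructor lbl
  field
    colour : ℕ
    Xs     : List ℕ     -- X (as a list; only membership matters)
    right  : Bool
    left   : Bool
    vertex : ℕ
open Label public

data STree : Set where
  nd : Label → List STree → STree

-- a rooted plane tree, given by the ordered list of subtrees of the root
Tree : Set
Tree = List STree

mutual
  mapT : (Label → Label) → STree → STree
  mapT f (nd l cs) = nd (f l) (mapF f cs)

  mapF : (Label → Label) → List STree → List STree
  mapF f []       = []
  mapF f (t ∷ ts) = mapT f t ∷ mapF f ts

-- Node addresses: a node is given by its path from the root
-- (list of child indices, 0 = first child).
Path : Set
Path = List ℕ

mutual
  nodesT : ℕ → STree → List (Path × Label)
  nodesT i (nd l cs) = (i ∷ [] , l) ∷ map (map₁ (i ∷_)) (nodesF 0 cs)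

  nodesF : ℕ → List STree → List (Path × Label)
  nodesF i []       = []
  nodesF i (t ∷ ts) = nodesT i t ++ nodesF (suc i) ts

nodes : Tree → List (Path × Label)
nodes T = nodesF 0 T

-- The construction t_A(G), as a relation (the choice of v among the
-- longest intervals meeting the first segment is arbitrary).

mod′ : Vtx → IGraph → Label → Label
mod′ v G l = record l
  { Xs    = if adj G (name v) (vertex l) ∧ not (left l) then col v ∷ Xs l else Xs l
  ; right = right l ∨ (inG′ v G (vertex l) ∧ inG″ v G (vertex l)) }

mod″ : Vtx → IGraph → Label → Label
mod″ v G l = record l
  { left = left l ∨ (inG′ v G (vertex l) ∧ inG″ v G (vertex l)) }

data IsT : List ℕ → IGraph → Tree → Set where
  empty : ∀ {A G} → verts G ≡ [] → IsT A G []
  step  : ∀ {A G T′ T″} (v : Vtx) (k : ℤ) →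
          v ∈ verts G →
          IsFirstSegment G k →
          MeetsSegment v k →
          (∀ {u} → u ∈ verts G → MeetsSegment u k → intervalLength u ℤ.≤ intervalLength v) →
          IsT (keep (λ a → not (eqᵇ a (col v))) A) (G′ v G) T′ →
          IsT A (G″ v G) T″ →
          IsT A G (nd (lbl (col v) [] false false (name v)) (mapF (mod′ v G) T′)
                   ∷ mapF (mod″ v G) T″)

countAssoc : ℕ → Tree → ℕ
countAssoc n T = length (filter (λ e → vertex (proj₂ e) ℕ.≟ n) (nodes T))

countAssocNoLeft : ℕ → Tree → ℕ
countAssocNoLeft n T =
  length (filter (λ e → (vertex (proj₂ e) ℕ.≟ n) ×-dec (left (proj₂ e) Data.Bool.≟ false)) (nodes T))
  where import Data.Bool

EdgePair : Tree → ℕ → ℕ → (Path × Label) × (Path × Label) → Set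
EdgePair T a b ((p , l) , (p′ , l′)) =
  (p , l) ∈ nodes T × (p′ , l′) ∈ nodes T ×
  ((vertex l ≡ a × vertex l′ ≡ b) ⊎ (vertex l ≡ b × vertex l′ ≡ a)) ×
  Prefix _≡_ p′ p ×
  colour l′ ∈ Xs l

module Submission where

-- Induction along the recursion defining t_A(G), with v the chosen vertex, T′ = t_{A∖{col v}}(G′) and
-- T″ = t_A(G″).  Apart from v, whose only node is the first child of the root, every vertex of G
-- lies in G′ (its interval meets J_v), in G″ (it reaches beyond J_v) or in both, and its nodes in T
-- are its nodes in T′ and T″.  A vertex in both meets the last segment of G′ and the first segment
-- of G″, so it has at most |A ∖ {col v}| + 1 = |A| nodes, and ← marks exactly its copies in T″.  Since col v
-- is the only colour inserted at this stage and col v ∉ A′, the edge pairs of T are those of T′,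
-- those of T″ (edges of G″ avoid G′), and one pair (node of w in T′ without ←, node of v) per
-- neighbour w of v.  To carry the induction the statement is strengthened (Invariant): every node
-- is associated with a vertex of G of the node's colour, second colour coordinates lie in A, and
-- every edge pair comes from an edge.

open import Defs
open import Data.Bool as Bool using (Bool; true; false; T?; not; _∧_)
open import Data.Bool.Properties
  using (T-≡; T-not-≡; T-∧; ¬-not; ∧-comm; ∨-zeroʳ; ∨-identityʳ; ∧-zeroʳ)
open import Data.Bool.ListAction using (any)
open import Data.Nat as ℕ using (ℕ; suc; _+_; _≤_; z≤n; s≤s)
import Data.Nat.Properties as ℕP
open import Data.Integer as ℤ using (ℤ; _⊔_; _⊓_; _-_; pred)
import Data.Integer.Properties as ℤP
open import Data.List using (List; []; _∷_; _++_; map; length; filter)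
open import Data.List.Properties
  using ( filter-all; filter-none; filter-accept; filter-reject; filter-≐; filter-++
        ; length-++; map-cong; map-∘; map-++)
open import Data.List.Membership.Propositional using (_∈_; _∉_; find; lose)
open import Data.List.Membership.Propositional.Properties
  using (∈-filter⁻; ∈-filter⁺; ∈-AllPairs₂; ∈-map⁻; ∈-map⁺; ∈-++⁻; ∈-++⁺ˡ; ∈-++⁺ʳ)
open import Data.List.Relation.Unary.Any using (here; there)
open import Data.List.Relation.Unary.Any.Properties using (any⁺; any⁻)
open import Data.List.Relation.Unary.All as All using (All; []; _∷_)
open import Data.List.Relation.Unary.AllPairs using ([]; _∷_)
import Data.List.Relation.Unary.AllPairs.Properties as AllPairs
open import Data.List.Relation.Unary.Unique.Propositional using (Unique)
import Data.List.Relation.Unary.Unique.Propositional.Properties as Unique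
open import Data.List.Relation.Binary.Prefix.Heterogeneous using (Prefix; []; _∷_; tail)
open import Data.Product as Product using (_×_; _,_; proj₁; proj₂; ∃; ∃₂; ∃!; map₁; map₂)
open import Data.Sum using (_⊎_; inj₁; inj₂)
open import Data.Empty using (⊥; ⊥-elim)
open import Function using (_∘_; case_of_; Equivalence)
open import Relation.Nullary using (¬_; Dec; yes; no; does; contradiction)
open import Relation.Nullary.Decidable
  using (_×-dec_; toWitness; fromWitness; toWitnessFalse; fromWitnessFalse)
open import Relation.Unary using (Decidable; _≐_)
open import Relation.Binary.PropositionalEquality

private
  variable
    X Y : Set

keep≡filter : (p : X → Bool) (xs : List X) → keep p xs ≡ filter (T? ∘ p) xs
keep≡filter p [] = refl
keep≡filter p (x ∷ xs) with p x
... | true  = cong (x ∷_) (keep≡filter p xs)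
... | false = keep≡filter p xs

∈-keep⁻ : (p : X → Bool) {x : X} (xs : List X) → x ∈ keep p xs → x ∈ xs × Bool.T (p x)
∈-keep⁻ p xs x∈ = ∈-filter⁻ (T? ∘ p) (subst (_ ∈_) (keep≡filter p xs) x∈)

∈-keep⁺ : (p : X → Bool) {x : X} (xs : List X) → x ∈ xs → Bool.T (p x) → x ∈ keep p xs
∈-keep⁺ p xs x∈ px = subst (_ ∈_) (sym (keep≡filter p xs)) (∈-filter⁺ (T? ∘ p) x∈ px)

keep-all : (p : X → Bool) (xs : List X) → All (Bool.T ∘ p) xs → keep p xs ≡ xs
keep-all p xs all = trans (keep≡filter p xs) (filter-all (T? ∘ p) all)

Unique-keep : (p : X → Bool) {xs : List X} → Unique xs → Unique (keep p xs)
Unique-keep p {xs} u = subst Unique (sym (keep≡filter p xs)) (Unique.filter⁺ (T? ∘ p) u)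

Unique-map-keep : (f : X → Y) (p : X → Bool) (xs : List X) →
                  Unique (map f xs) → Unique (map f (keep p xs))
Unique-map-keep f p xs u = subst (Unique ∘ map f) (sym (keep≡filter p xs))
  (AllPairs.map⁺ (AllPairs.filter⁺ (T? ∘ p) (AllPairs.map⁻ u)))

Unique-map⇒injective : (f : X → Y) {xs : List X} → Unique (map f xs) →
                       ∀ {x y} → x ∈ xs → y ∈ xs → f x ≡ f y → x ≡ y
Unique-map⇒injective f u x∈ y∈ fx≡fy with ∈-AllPairs₂ (AllPairs.map⁻ u) x∈ y∈
... | inj₁ x≡y        = x≡y
... | inj₂ (inj₁ fx≢fy) = contradiction fx≡fy fx≢fy
... | inj₂ (inj₂ fy≢fx) = contradiction (sym fx≡fy) fy≢fx

without : ℕ → List ℕ → List ℕ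
without c = keep (λ a → not (eqᵇ a c))

eqᵇ-refl : ∀ c → eqᵇ c c ≡ true
eqᵇ-refl c = Equivalence.to T-≡ (fromWitness {a? = c ℕ.≟ c} refl)

eqᵇ-≢ : ∀ {a c} → a ≢ c → eqᵇ a c ≡ false
eqᵇ-≢ a≢c = Equivalence.to T-not-≡ (fromWitnessFalse a≢c)

c∉without : (c : ℕ) (A : List ℕ) → c ∉ without c A
c∉without c A c∈ = toWitnessFalse (proj₂ (∈-keep⁻ _ A c∈)) refl

without-⊆ : ∀ {c a} (A : List ℕ) → a ∈ without c A → a ∈ A
without-⊆ A a∈ = proj₁ (∈-keep⁻ _ A a∈)

∈-without⁺ : ∀ {c a} (A : List ℕ) → a ∈ A → a ≢ c → a ∈ without c A
∈-without⁺ A a∈ a≢c = ∈-keep⁺ _ A a∈ (fromWitnessFalse a≢c)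

length-without : ∀ {c} (A : List ℕ) → Unique A → c ∈ A → length A ≡ suc (length (without c A))
length-without {c} (c ∷ B) (c∉B ∷ _) (here refl) rewrite eqᵇ-refl c =
  cong suc (cong length (sym (keep-all _ B (All.map (λ c≢b → fromWitnessFalse (c≢b ∘ sym)) c∉B))))
length-without {c} (b ∷ B) (b∉B ∷ uB) (there c∈B) rewrite eqᵇ-≢ (All.lookup b∉B c∈B) =
  cong suc (length-without B uB c∈B)


length-filter-map : {P : X → Set} (P? : Decidable P) (f : Y → X) (xs : List Y) →
                    length (filter P? (map f xs)) ≡ length (filter (P? ∘ f) xs)
length-filter-map P? f [] = refl
length-filter-map P? f (x ∷ xs) with does (P? (f x))
... | true  = cong suc (length-filter-map P? f xs)
... | false = length-filter-map P? f xs

length-filter-none : {P : X → Set} (P? : Decidable P) (xs : List X) →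
                     (∀ {x} → x ∈ xs → ¬ P x) → length (filter P? xs) ≡ 0
length-filter-none P? xs ¬P = cong length (filter-none P? (All.tabulate ¬P))

length-filter≡1⇒≡ : {P : X → Set} (P? : Decidable P) (xs : List X) → length (filter P? xs) ≡ 1 →
                    ∀ {x y} → x ∈ xs → P x → y ∈ xs → P y → x ≡ y
length-filter≡1⇒≡ P? xs len≡1 {x} {y} x∈ px y∈ py
  with filter P? xs | ∈-filter⁺ P? x∈ px | ∈-filter⁺ P? y∈ py
... | _ ∷ [] | here refl | here refl = refl

length-filter≡1⇒∃ : {P : X → Set} (P? : Decidable P) (xs : List X) → length (filter P? xs) ≡ 1 →
                    ∃ λ x → x ∈ xs × P x
length-filter≡1⇒∃ P? xs len≡1 with filter P? xs in eq
... | x ∷ [] = x , ∈-filter⁻ P? {xs = xs} (subst (x ∈_) (sym eq) (here refl))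

⊔-lub-< : ∀ {a b c} → a ℤ.< c → b ℤ.< c → a ⊔ b ℤ.< c
⊔-lub-< {a} {b} a<c b<c with ℤP.⊔-sel a b
... | inj₁ eq rewrite eq = a<c
... | inj₂ eq rewrite eq = b<c

⊓-glb-< : ∀ {a b c} → a ℤ.< b → a ℤ.< c → a ℤ.< b ⊓ c
⊓-glb-< {a} {b} {c} a<b a<c with ℤP.⊓-sel b c
... | inj₁ eq rewrite eq = a<b
... | inj₂ eq rewrite eq = a<c

i-k≤j-k⇒i≤j : ∀ {i j} k → i - k ℤ.≤ j - k → i ℤ.≤ j
i-k≤j-k⇒i≤j {i} {j} k i-k≤j-k = subst₂ ℤ._≤_ (-k+k i) (-k+k j) (ℤP.+-monoˡ-≤ k i-k≤j-k)
  where
  open ≡-Reasoning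
  -k+k : ∀ x → x - k ℤ.+ k ≡ x
  -k+k x = begin
    x - k ℤ.+ k           ≡⟨ ℤP.+-assoc x (ℤ.- k) k ⟩
    x ℤ.+ (ℤ.- k ℤ.+ k)   ≡⟨ cong (λ y → x ℤ.+ y) (ℤP.+-inverseˡ k) ⟩
    x ℤ.+ ℤ.+ 0           ≡⟨ ℤP.+-identityʳ x ⟩
    x                     ∎

pred<self : ∀ b → pred b ℤ.< b
pred<self b = ℤP.i≤pred[j]⇒i<j ℤP.≤-refl

pred<⇒≤ : ∀ {a b} → pred a ℤ.< b → a ℤ.≤ b
pred<⇒≤ {a} p = subst (ℤ._≤ _) (ℤP.suc-pred a) (ℤP.i<j⇒suc[i]≤j p)

∧≡true⇒ : ∀ {a b} → a ∧ b ≡ true → a ≡ true × b ≡ true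
∧≡true⇒ {true} {true} _ = refl , refl

NameIn : List Vtx → ℕ → Set
NameIn xs n = ∃ λ u → u ∈ xs × name u ≡ n

any-name⁺ : ∀ {n} (xs : List Vtx) → NameIn xs n → any (λ u → eqᵇ (name u) n) xs ≡ true
any-name⁺ xs (u , u∈ , refl) = Equivalence.to T-≡ (any⁺ _ (lose u∈ (fromWitness refl)))

any-name⁻ : ∀ {n} (xs : List Vtx) → any (λ u → eqᵇ (name u) n) xs ≡ true → NameIn xs n
any-name⁻ xs eq with find (any⁻ _ xs (Equivalence.from T-≡ eq))
... | u , u∈ , t = u , u∈ , toWitness t

any-name-∉ : ∀ {n} (xs : List Vtx) → ¬ NameIn xs n → any (λ u → eqᵇ (name u) n) xs ≡ false
any-name-∉ xs ∉ = ¬-not (∉ ∘ any-name⁻ xs)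

restrict′ : Vtx → Vtx → Vtx
restrict′ v u = record u { lo = lo u ⊔ lo v ; hi = hi u ⊓ hi v }

restrict″ : Vtx → Vtx → Vtx
restrict″ v u = record u { lo = lo u ⊔ hi v }

selects′ : Vtx → Vtx → Bool
selects′ v u = not (eqᵇ (name u) (name v)) ∧ intersectsᵇ u v

selects″ : Vtx → Vtx → Bool
selects″ v u = ltᵇ (hi v) (hi u)

intersect? : ∀ u w → Dec (Intersect u w)
intersect? u w = (lo u ℤ.<? hi w) ×-dec (lo w ℤ.<? hi u)

T-intersectsᵇ⁻ : ∀ {u w} → Bool.T (intersectsᵇ u w) → Intersect u w
T-intersectsᵇ⁻ {u} {w} t =
  let (t₁ , t₂) = Equivalence.to (T-∧ {ltᵇ (lo u) (hi w)}) t in toWitness t₁ , toWitness t₂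

T-intersectsᵇ⁺ : ∀ {u w} → Intersect u w → Bool.T (intersectsᵇ u w)
T-intersectsᵇ⁺ {u} {w} (p , q) =
  Equivalence.from (T-∧ {ltᵇ (lo u) (hi w)}) (fromWitness p , fromWitness q)

module Restriction (v : Vtx) (G : IGraph) where

  ∈G′⁻ : ∀ {u′} → u′ ∈ verts (G′ v G) →
         ∃ λ u → u ∈ verts G × name u ≢ name v × Intersect u v × u′ ≡ restrict′ v u
  ∈G′⁻ u′∈ with ∈-map⁻ (restrict′ v) u′∈
  ... | u , u∈keep , refl with ∈-keep⁻ (selects′ v) (verts G) u∈keep
  ... | u∈ , t with Equivalence.to (T-∧ {not (eqᵇ (name u) (name v))}) t
  ... | t₁ , t₂ =
    u , u∈ , toWitnessFalse {a? = name u ℕ.≟ name v} t₁ , T-intersectsᵇ⁻ {u} {v} t₂ , refl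

  ∈G′⁺ : ∀ {u} → u ∈ verts G → name u ≢ name v → Intersect u v → restrict′ v u ∈ verts (G′ v G)
  ∈G′⁺ {u} u∈ u≢v i = ∈-map⁺ (restrict′ v) (∈-keep⁺ (selects′ v) (verts G) u∈
    (Equivalence.from (T-∧ {not (eqᵇ (name u) (name v))})
                      (fromWitnessFalse u≢v , T-intersectsᵇ⁺ {u} {v} i)))

  ∈G″⁻ : ∀ {u″} → u″ ∈ verts (G″ v G) → ∃ λ u → u ∈ verts G × hi v ℤ.< hi u × u″ ≡ restrict″ v u
  ∈G″⁻ u″∈ with ∈-map⁻ (restrict″ v) u″∈
  ... | u , u∈keep , refl with ∈-keep⁻ (selects″ v) (verts G) u∈keep
  ... | u∈ , t = u , u∈ , toWitness t , refl

  ∈G″⁺ : ∀ {u} → u ∈ verts G → hi v ℤ.< hi u → restrict″ v u ∈ verts (G″ v G)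
  ∈G″⁺ u∈ hv<hu = ∈-map⁺ (restrict″ v) (∈-keep⁺ (selects″ v) (verts G) u∈ (fromWitness hv<hu))

restrict-preserves-Unique : (r : Vtx → Vtx) (p : Vtx → Bool) (us : List Vtx) →
                            (∀ u → name (r u) ≡ name u) →
                            Unique (map name us) → Unique (map name (map r (keep p us)))
restrict-preserves-Unique r p us name-r u = subst Unique names≡ (Unique-map-keep name p us u)
  where
  names≡ : map name (keep p us) ≡ map name (map r (keep p us))
  names≡ = trans (map-cong (sym ∘ name-r) (keep p us)) (map-∘ (keep p us))

module _ {A : List ℕ} {G : IGraph} (ig : IsAIntervalGraph A G) {v : Vtx} (v∈ : v ∈ verts G) where
  open IsAIntervalGraph ig
  open Restriction v G

  G′-isAIntervalGraph : IsAIntervalGraph (without (col v) A) (G′ v G)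
  G′-isAIntervalGraph = record
    { names-unique =
        restrict-preserves-Unique (restrict′ v) (selects′ v) (verts G) (λ _ → refl) names-unique
    ; interval-nonempty = nonempty
    ; colour-in-A = colour-in
    ; adj-sym = symmetric
    ; adj-irrefl = irreflexive
    ; adj⇒intersect = adj⇒intersect′
    ; intersect⇒colours-differ = colours-differ
    }
    where
    symmetric : ∀ {u w} → u ∈ verts (G′ v G) → w ∈ verts (G′ v G) →
                adj G (name u) (name w) ≡ adj G (name w) (name u)
    symmetric m₁ m₂ with ∈G′⁻ m₁ | ∈G′⁻ m₂
    ... | u , u∈ , _ , _ , refl | w , w∈ , _ , _ , refl = adj-sym u∈ w∈
    irreflexive : ∀ {u} → u ∈ verts (G′ v G) → adj G (name u) (name u) ≡ false
    irreflexive m with ∈G′⁻ m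
    ... | u , u∈ , _ , _ , refl = adj-irrefl u∈
    nonempty : ∀ {u} → u ∈ verts (G′ v G) → lo u ℤ.< hi u
    nonempty m with ∈G′⁻ m
    ... | u , u∈ , _ , (lu<hv , lv<hu) , refl =
      ⊓-glb-< (⊔-lub-< (interval-nonempty u∈) lv<hu) (⊔-lub-< lu<hv (interval-nonempty v∈))
    colour-in : ∀ {u} → u ∈ verts (G′ v G) → col u ∈ without (col v) A
    colour-in m with ∈G′⁻ m
    ... | u , u∈ , u≢v , i , refl =
      ∈-without⁺ A (colour-in-A u∈) (intersect⇒colours-differ u∈ v∈ u≢v i)
    adj⇒intersect′ : ∀ {u w} → u ∈ verts (G′ v G) → w ∈ verts (G′ v G) →
                     adj G (name u) (name w) ≡ true → Intersect u w
    adj⇒intersect′ m₁ m₂ e with ∈G′⁻ m₁ | ∈G′⁻ m₂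
    ... | u , u∈ , _ , (lu<hv , lv<hu) , refl | w , w∈ , _ , (lw<hv , lv<hw) , refl
      with adj⇒intersect u∈ w∈ e
    ... | lu<hw , lw<hu =
      ⊓-glb-< (⊔-lub-< lu<hw lv<hw) (⊔-lub-< lu<hv (interval-nonempty v∈)) ,
      ⊓-glb-< (⊔-lub-< lw<hu lv<hu) (⊔-lub-< lw<hv (interval-nonempty v∈))
    colours-differ : ∀ {u w} → u ∈ verts (G′ v G) → w ∈ verts (G′ v G) → name u ≢ name w →
                     Intersect u w → col u ≢ col w
    colours-differ m₁ m₂ u≢w (lu<hw , lw<hu) with ∈G′⁻ m₁ | ∈G′⁻ m₂
    ... | u , u∈ , _ , _ , refl | w , w∈ , _ , _ , refl = intersect⇒colours-differ u∈ w∈ u≢w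
      ( ℤP.≤-<-trans (ℤP.i≤i⊔j (lo u) (lo v)) (ℤP.<-≤-trans lu<hw (ℤP.i⊓j≤i (hi w) (hi v)))
      , ℤP.≤-<-trans (ℤP.i≤i⊔j (lo w) (lo v)) (ℤP.<-≤-trans lw<hu (ℤP.i⊓j≤i (hi u) (hi v))))

  G″-isAIntervalGraph : IsAIntervalGraph A (G″ v G)
  G″-isAIntervalGraph = record
    { names-unique =
        restrict-preserves-Unique (restrict″ v) (selects″ v) (verts G) (λ _ → refl) names-unique
    ; interval-nonempty = nonempty
    ; colour-in-A = colour-in
    ; adj-sym = symmetric
    ; adj-irrefl = irreflexive
    ; adj⇒intersect = adj⇒intersect″
    ; intersect⇒colours-differ = colours-differ
    }
    where
    colour-in : ∀ {u} → u ∈ verts (G″ v G) → col u ∈ A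
    colour-in m with ∈G″⁻ m
    ... | u , u∈ , _ , refl = colour-in-A u∈
    symmetric : ∀ {u w} → u ∈ verts (G″ v G) → w ∈ verts (G″ v G) →
                adj (G″ v G) (name u) (name w) ≡ adj (G″ v G) (name w) (name u)
    symmetric m₁ m₂ with ∈G″⁻ m₁ | ∈G″⁻ m₂
    ... | u , u∈ , _ , refl | w , w∈ , _ , refl =
      cong₂ (λ a b → a ∧ not b) (adj-sym u∈ w∈) (∧-comm (inG′ v G (name u)) (inG′ v G (name w)))
    irreflexive : ∀ {u} → u ∈ verts (G″ v G) → adj (G″ v G) (name u) (name u) ≡ false
    irreflexive m with ∈G″⁻ m
    ... | u , u∈ , _ , refl = cong (_∧ _) (adj-irrefl u∈)
    nonempty : ∀ {u} → u ∈ verts (G″ v G) → lo u ℤ.< hi u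
    nonempty m with ∈G″⁻ m
    ... | u , u∈ , hv<hu , refl = ⊔-lub-< (interval-nonempty u∈) hv<hu
    adj⇒intersect″ : ∀ {u w} → u ∈ verts (G″ v G) → w ∈ verts (G″ v G) →
                     adj (G″ v G) (name u) (name w) ≡ true → Intersect u w
    adj⇒intersect″ m₁ m₂ e with ∈G″⁻ m₁ | ∈G″⁻ m₂
    ... | u , u∈ , hv<hu , refl | w , w∈ , hv<hw , refl
      with adj⇒intersect u∈ w∈ (proj₁ (∧≡true⇒ e))
    ... | lu<hw , lw<hu = ⊔-lub-< lu<hw hv<hw , ⊔-lub-< lw<hu hv<hu
    colours-differ : ∀ {u w} → u ∈ verts (G″ v G) → w ∈ verts (G″ v G) → name u ≢ name w →
                     Intersect u w → col u ≢ col w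
    colours-differ m₁ m₂ u≢w (lu<hw , lw<hu) with ∈G″⁻ m₁ | ∈G″⁻ m₂
    ... | u , u∈ , _ , refl | w , w∈ , _ , refl = intersect⇒colours-differ u∈ w∈ u≢w
      (ℤP.≤-<-trans (ℤP.i≤i⊔j (lo u) (hi v)) lu<hw , ℤP.≤-<-trans (ℤP.i≤i⊔j (lo w) (hi v)) lw<hu)

module Chosen {A : List ℕ} {G : IGraph} (ig : IsAIntervalGraph A G)
  {v : Vtx} {k : ℤ} (v∈ : v ∈ verts G) (first : IsFirstSegment G k) (v-meets : MeetsSegment v k)
  (longest : ∀ {u} → u ∈ verts G → MeetsSegment u k → intervalLength u ℤ.≤ intervalLength v) where

  open IsAIntervalGraph ig
  open Restriction v G public

  name-injective : ∀ {u w} → u ∈ verts G → w ∈ verts G → name u ≡ name w → u ≡ w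
  name-injective = Unique-map⇒injective name names-unique

  k≤lo : ∀ {u} → u ∈ verts G → k ℤ.≤ lo u
  k≤lo u∈ = proj₂ first u∈ (ℤP.≤-refl , interval-nonempty u∈)

  lo-v≡k : lo v ≡ k
  lo-v≡k = ℤP.≤-antisym (proj₁ v-meets) (k≤lo v∈)

  first-segment-unique : ∀ {k₁} → IsFirstSegment G k₁ → k₁ ≡ k
  first-segment-unique ((w , w∈ , w-meets) , k₁-least) =
    ℤP.≤-antisym (k₁-least v∈ v-meets) (proj₂ first w∈ w-meets)

  meets-first⇒lo≡k : ∀ {u} → u ∈ verts G → MeetsSegment u k → lo u ≡ k
  meets-first⇒lo≡k u∈ u-meets = ℤP.≤-antisym (proj₁ u-meets) (k≤lo u∈)

  meets-first⇒hi≤hi-v : ∀ {u} → u ∈ verts G → MeetsSegment u k → hi u ℤ.≤ hi v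
  meets-first⇒hi≤hi-v {u} u∈ u-meets = i-k≤j-k⇒i≤j k
    (subst₂ (λ a b → hi u ℤ.- a ℤ.≤ hi v ℤ.- b)
            (meets-first⇒lo≡k u∈ u-meets) lo-v≡k (longest u∈ u-meets))

  meets-first⇒intersects : ∀ {u} → MeetsSegment u k → Intersect u v
  meets-first⇒intersects (lu≤k , k<hu) =
    ℤP.≤-<-trans lu≤k (proj₂ v-meets) , subst (ℤ._< _) (sym lo-v≡k) k<hu

  disjoint⇒hi-v≤lo : ∀ {u} → u ∈ verts G → ¬ Intersect u v → hi v ℤ.≤ lo u
  disjoint⇒hi-v≤lo {u} u∈ disj = ℤP.≮⇒≥ λ lu<hv →
    disj (lu<hv , subst (ℤ._< hi u) (sym lo-v≡k) (ℤP.≤-<-trans (k≤lo u∈) (interval-nonempty u∈)))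

  disjoint⇒hi-v<hi : ∀ {u} → u ∈ verts G → ¬ Intersect u v → hi v ℤ.< hi u
  disjoint⇒hi-v<hi u∈ disj = ℤP.≤-<-trans (disjoint⇒hi-v≤lo u∈ disj) (interval-nonempty u∈)

  meets-last⇒hi-v≤hi : ∀ {k′ u} → IsLastSegment G k′ → MeetsSegment u k′ → hi v ℤ.≤ hi u
  meets-last⇒hi-v≤hi last u-meets = pred<⇒≤
    (ℤP.≤-<-trans (proj₂ last v∈ (ℤP.i<j⇒i≤pred[j] (interval-nonempty v∈) , pred<self (hi v)))
                  (proj₂ u-meets))

  G′-first : ∀ {u} → u ∈ verts G → MeetsSegment u k → name u ≢ name v →
             IsFirstSegment (G′ v G) k × MeetsSegment (restrict′ v u) k
  G′-first {u} u∈ u-meets u≢v =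
    ((restrict′ v u , ∈G′⁺ u∈ u≢v (meets-first⇒intersects {u} u-meets) , meets) , least) , meets
    where
    meets : MeetsSegment (restrict′ v u) k
    meets = ℤP.⊔-lub (proj₁ u-meets) (proj₁ v-meets) , ⊓-glb-< (proj₂ u-meets) (proj₂ v-meets)
    least : ∀ {w j} → w ∈ verts (G′ v G) → MeetsSegment w j → k ℤ.≤ j
    least w∈ (lw≤j , _) with ∈G′⁻ w∈
    ... | w , _ , _ , _ , refl = ℤP.≤-trans (subst (ℤ._≤ _) lo-v≡k (ℤP.i≤j⊔i (lo w) (lo v))) lw≤j

  G′-last : ∀ {u} → u ∈ verts G → name u ≢ name v → Intersect u v → hi v ℤ.≤ hi u →
            IsLastSegment (G′ v G) (pred (hi v)) × MeetsSegment (restrict′ v u) (pred (hi v))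
  G′-last {u} u∈ u≢v i hv≤hu = ((restrict′ v u , ∈G′⁺ u∈ u≢v i , meets) , greatest) , meets
    where
    meets : MeetsSegment (restrict′ v u) (pred (hi v))
    meets = ℤP.⊔-lub (ℤP.i<j⇒i≤pred[j] (proj₁ i)) (ℤP.i<j⇒i≤pred[j] (interval-nonempty v∈))
          , ⊓-glb-< (ℤP.<-≤-trans (pred<self (hi v)) hv≤hu) (pred<self (hi v))
    greatest : ∀ {w j} → w ∈ verts (G′ v G) → MeetsSegment w j → j ℤ.≤ pred (hi v)
    greatest w∈ (_ , j<hw) with ∈G′⁻ w∈
    ... | w , _ , _ , _ , refl = ℤP.i<j⇒i≤pred[j] (ℤP.<-≤-trans j<hw (ℤP.i⊓j≤j (hi w) (hi v)))

  G″-first : ∀ {u} → u ∈ verts G → Intersect u v → hi v ℤ.< hi u →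
             IsFirstSegment (G″ v G) (hi v) × MeetsSegment (restrict″ v u) (hi v)
  G″-first {u} u∈ i hv<hu = ((restrict″ v u , ∈G″⁺ u∈ hv<hu , meets) , least) , meets
    where
    meets : MeetsSegment (restrict″ v u) (hi v)
    meets = ℤP.⊔-lub (ℤP.<⇒≤ (proj₁ i)) ℤP.≤-refl , hv<hu
    least : ∀ {w j} → w ∈ verts (G″ v G) → MeetsSegment w j → hi v ℤ.≤ j
    least w∈ (lw≤j , _) with ∈G″⁻ w∈
    ... | w , _ , _ , refl = ℤP.≤-trans (ℤP.i≤j⊔i (lo w) (hi v)) lw≤j

  G″-last : ∀ {k′ u} → IsLastSegment G k′ → u ∈ verts G → MeetsSegment u k′ → hi v ℤ.< hi u →
            IsLastSegment (G″ v G) k′ × MeetsSegment (restrict″ v u) k′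
  G″-last {k′} {u} last u∈ u-meets hv<hu =
    ((restrict″ v u , ∈G″⁺ u∈ hv<hu , meets) , greatest) , meets
    where
    hv≤k′ : hi v ℤ.≤ k′
    hv≤k′ = ℤP.≤-trans (ℤP.i<j⇒i≤pred[j] hv<hu)
              (proj₂ last u∈ (ℤP.i<j⇒i≤pred[j] (interval-nonempty u∈) , pred<self (hi u)))
    meets : MeetsSegment (restrict″ v u) k′
    meets = ℤP.⊔-lub (proj₁ u-meets) hv≤k′ , proj₂ u-meets
    greatest : ∀ {w j} → w ∈ verts (G″ v G) → MeetsSegment w j → j ℤ.≤ k′
    greatest w∈ (lw≤j , j<hw) with ∈G″⁻ w∈
    ... | w , w∈ , _ , refl = proj₂ last w∈ (ℤP.≤-trans (ℤP.i≤i⊔j (lo w) (hi v)) lw≤j , j<hw)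

  nameInG′⁻ : ∀ {n} → NameIn (verts (G′ v G)) n →
              ∃ λ u → u ∈ verts G × name u ≡ n × name u ≢ name v × Intersect u v
  nameInG′⁻ (u′ , u′∈ , refl) with ∈G′⁻ u′∈
  ... | u , u∈ , u≢v , i , refl = u , u∈ , refl , u≢v , i

  nameInG′⇒inG : ∀ {n} → NameIn (verts (G′ v G)) n → NameIn (verts G) n
  nameInG′⇒inG nm = let (u , u∈ , eq , _) = nameInG′⁻ nm in u , u∈ , eq

  nameInG′⇒intersects : ∀ {u} → u ∈ verts G → NameIn (verts (G′ v G)) (name u) →
                        name u ≢ name v × Intersect u v
  nameInG′⇒intersects u∈ nm with nameInG′⁻ nm
  ... | w , w∈ , eq , w≢v , i with name-injective w∈ u∈ eq
  ... | refl = w≢v , i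

  nameInG″⇒hi-v<hi : ∀ {u} → u ∈ verts G → NameIn (verts (G″ v G)) (name u) → hi v ℤ.< hi u
  nameInG″⇒hi-v<hi u∈ (u″ , u″∈ , eq) with ∈G″⁻ u″∈
  ... | w , w∈ , hv<hw , refl with name-injective w∈ u∈ eq
  ... | refl = hv<hw

  v∉G′ : ¬ NameIn (verts (G′ v G)) (name v)
  v∉G′ nm = proj₁ (nameInG′⇒intersects v∈ nm) refl

  v∉G″ : ¬ NameIn (verts (G″ v G)) (name v)
  v∉G″ nm = ℤP.<-irrefl refl (nameInG″⇒hi-v<hi v∈ nm)

  nameInG′⇒≢v : ∀ {n} → NameIn (verts (G′ v G)) n → n ≢ name v
  nameInG′⇒≢v nm refl = v∉G′ nm

  within⇒∉G″ : ∀ {u} → u ∈ verts G → hi u ℤ.≤ hi v → ¬ NameIn (verts (G″ v G)) (name u)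
  within⇒∉G″ u∈ hu≤hv nm = ℤP.<⇒≱ (nameInG″⇒hi-v<hi u∈ nm) hu≤hv

  disjoint⇒∉G′ : ∀ {u} → u ∈ verts G → ¬ Intersect u v → ¬ NameIn (verts (G′ v G)) (name u)
  disjoint⇒∉G′ u∈ disj nm = disj (proj₂ (nameInG′⇒intersects u∈ nm))

  nameInG′⁺ : ∀ {u} → u ∈ verts G → name u ≢ name v → Intersect u v → NameIn (verts (G′ v G)) (name u)
  nameInG′⁺ u∈ u≢v i = _ , ∈G′⁺ u∈ u≢v i , refl

  -- within: only in G′;  beyond: only in G″;  across: in both.
  data Position (u : Vtx) : Set where
    chosen : u ≡ v → Position u
    within : name u ≢ name v → Intersect u v → hi u ℤ.≤ hi v → Position u
    beyond : name u ≢ name v → ¬ Intersect u v → Position u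
    across : name u ≢ name v → Intersect u v → hi v ℤ.< hi u → Position u

  position : ∀ {u} → u ∈ verts G → Position u
  position {u} u∈ with name u ℕ.≟ name v
  ... | yes u≡v = chosen (name-injective u∈ v∈ u≡v)
  ... | no u≢v with intersect? u v | hi v ℤ.<? hi u
  ...   | no disj | _        = beyond u≢v disj
  ...   | yes i   | yes hv<hu = across u≢v i hv<hu
  ...   | yes i   | no hv≮hu  = within u≢v i (ℤP.≮⇒≥ hv≮hu)

bump : Path → Path
bump []      = []
bump (j ∷ p) = suc j ∷ p

nodesT-shift : ∀ i t → nodesT (suc i) t ≡ map (map₁ bump) (nodesT i t)
nodesT-shift i (nd l cs) = cong ((suc i ∷ [] , l) ∷_) (map-∘ (nodesF 0 cs))

nodesF-shift : ∀ i ts → nodesF (suc i) ts ≡ map (map₁ bump) (nodesF i ts)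
nodesF-shift i []       = refl
nodesF-shift i (t ∷ ts) =
  trans (cong₂ _++_ (nodesT-shift i t) (nodesF-shift (suc i) ts)) (sym (map-++ _ (nodesT i t) _))

mutual
  nodesT-mapT : ∀ f i t → nodesT i (mapT f t) ≡ map (map₂ f) (nodesT i t)
  nodesT-mapT f i (nd l cs) = cong ((i ∷ [] , f l) ∷_)
    (trans (cong (map (map₁ (i ∷_))) (nodesF-mapF f 0 cs))
      (trans (sym (map-∘ (nodesF 0 cs))) (map-∘ (nodesF 0 cs))))

  nodesF-mapF : ∀ f i ts → nodesF i (mapF f ts) ≡ map (map₂ f) (nodesF i ts)
  nodesF-mapF f i []       = refl
  nodesF-mapF f i (t ∷ ts) =
    trans (cong₂ _++_ (nodesT-mapT f i t) (nodesF-mapF f (suc i) ts)) (sym (map-++ _ (nodesT i t) _))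

nodesT-path : ∀ {i e} t → e ∈ nodesT i t → ∃ λ q → proj₁ e ≡ i ∷ q
nodesT-path (nd l cs) (here refl) = [] , refl
nodesT-path (nd l cs) (there e∈) with ∈-map⁻ (map₁ (_ ∷_)) e∈
... | x , _ , refl = proj₁ x , refl

nodesF-path : ∀ {i e} ts → e ∈ nodesF i ts → ∃₂ λ j q → proj₁ e ≡ j ∷ q
nodesF-path {i} (t ∷ ts) e∈ with ∈-++⁻ (nodesT i t) e∈
... | inj₁ e∈t  = i , nodesT-path t e∈t
... | inj₂ e∈ts = nodesF-path ts e∈ts

liftFirst : (Label → Label) → Path × Label → Path × Label
liftFirst f e = 0 ∷ proj₁ e , f (proj₂ e)

liftRest : (Label → Label) → Path × Label → Path × Label
liftRest g e = bump (proj₁ e) , g (proj₂ e)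

Prefix-bump⁺ : ∀ {p q} → Prefix _≡_ p q → Prefix _≡_ (bump p) (bump q)
Prefix-bump⁺ []         = []
Prefix-bump⁺ (refl ∷ r) = refl ∷ r

Prefix-bump⁻ : ∀ {p q} → Prefix _≡_ (bump p) (bump q) → Prefix _≡_ p q
Prefix-bump⁻ {[]}    _          = []
Prefix-bump⁻ {_ ∷ _} {_ ∷ _} (refl ∷ r) = refl ∷ r

module StepTree (l : Label) (f g : Label → Label) (T′ T″ : Tree) where

  root : Path × Label
  root = 0 ∷ [] , l

  T : Tree
  T = nd l (mapF f T′) ∷ mapF g T″

  nodes-step : nodes T ≡ root ∷ (map (liftFirst f) (nodes T′) ++ map (liftRest g) (nodes T″))
  nodes-step = cong (root ∷_) (cong₂ _++_ first rest)
    where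
    first : map (map₁ (0 ∷_)) (nodesF 0 (mapF f T′)) ≡ map (liftFirst f) (nodes T′)
    first = trans (cong (map (map₁ (0 ∷_))) (nodesF-mapF f 0 T′)) (sym (map-∘ (nodes T′)))
    rest : nodesF 1 (mapF g T″) ≡ map (liftRest g) (nodes T″)
    rest = trans (nodesF-shift 0 (mapF g T″))
             (trans (cong (map (map₁ bump)) (nodesF-mapF g 0 T″)) (sym (map-∘ (nodes T″))))

  data Node : Path × Label → Set where
    root-node  : Node root
    first-node : ∀ {x} → x ∈ nodes T′ → Node (liftFirst f x)
    rest-node  : ∀ {x} → x ∈ nodes T″ → Node (liftRest g x)

  node-view : ∀ {e} → e ∈ nodes T → Node e
  node-view {e} e∈ with subst (e ∈_) nodes-step e∈
  ... | here refl = root-node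
  ... | there e∈′ with ∈-++⁻ (map (liftFirst f) (nodes T′)) e∈′
  ...   | inj₁ e∈₁ with ∈-map⁻ (liftFirst f) e∈₁
  ...     | x , x∈ , refl = first-node x∈
  node-view _ | there _ | inj₂ e∈₂ with ∈-map⁻ (liftRest g) e∈₂
  ...     | x , x∈ , refl = rest-node x∈

  root∈nodes : root ∈ nodes T
  root∈nodes = subst (root ∈_) (sym nodes-step) (here refl)

  liftFirst∈nodes : ∀ {x} → x ∈ nodes T′ → liftFirst f x ∈ nodes T
  liftFirst∈nodes {x} x∈ =
    subst (liftFirst f x ∈_) (sym nodes-step) (there (∈-++⁺ˡ (∈-map⁺ (liftFirst f) x∈)))

  liftRest∈nodes : ∀ {x} → x ∈ nodes T″ → liftRest g x ∈ nodes T
  liftRest∈nodes {x} x∈ =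
    subst (liftRest g x ∈_) (sym nodes-step)
      (there (∈-++⁺ʳ (map (liftFirst f) (nodes T′)) (∈-map⁺ (liftRest g) x∈)))

  ¬rest≼first : ∀ {x p} → x ∈ nodes T″ → ¬ Prefix _≡_ (proj₁ (liftRest g x)) (0 ∷ p)
  ¬rest≼first x∈ rest≼first with nodesF-path T″ x∈ | rest≼first
  ... | _ , _ , eq | pre rewrite eq with pre
  ... | () ∷ _

  ¬first≼rest : ∀ {x p} → x ∈ nodes T″ → ¬ Prefix _≡_ (0 ∷ p) (proj₁ (liftRest g x))
  ¬first≼rest x∈ first≼rest with nodesF-path T″ x∈ | first≼rest
  ... | _ , _ , eq | pre rewrite eq with pre
  ... | () ∷ _

  length-filter-nodes : ∀ {P : Path × Label → Set} (P? : Decidable P) →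
    length (filter P? (nodes T)) ≡
    length (filter P? (root ∷ [])) + (length (filter (P? ∘ liftFirst f) (nodes T′)) +
                                      length (filter (P? ∘ liftRest g) (nodes T″)))
  length-filter-nodes P? = begin
    length (filter P? (nodes T))
      ≡⟨ cong (length ∘ filter P?) nodes-step ⟩
    length (filter P? (root ∷ [] ++ firsts ++ rests))
      ≡⟨ length-filter-++ (root ∷ []) (firsts ++ rests) ⟩
    length (filter P? (root ∷ [])) + length (filter P? (firsts ++ rests))
      ≡⟨ cong (length (filter P? (root ∷ [])) +_) (length-filter-++ firsts rests) ⟩
    length (filter P? (root ∷ [])) + (length (filter P? firsts) + length (filter P? rests))
      ≡⟨ cong (length (filter P? (root ∷ [])) +_)
           (cong₂ _+_ (length-filter-map P? (liftFirst f) (nodes T′))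
                      (length-filter-map P? (liftRest g) (nodes T″))) ⟩
    length (filter P? (root ∷ [])) + (length (filter (P? ∘ liftFirst f) (nodes T′)) +
                                      length (filter (P? ∘ liftRest g) (nodes T″))) ∎
    where
    open ≡-Reasoning
    firsts = map (liftFirst f) (nodes T′)
    rests = map (liftRest g) (nodes T″)
    length-filter-++ : ∀ xs ys →
                       length (filter P? (xs ++ ys)) ≡ length (filter P? xs) + length (filter P? ys)
    length-filter-++ xs ys = trans (cong length (filter-++ P? xs ys)) (length-++ (filter P? xs))

Endpoints : ℕ → ℕ → ℕ → ℕ → Set
Endpoints a b x y = (x ≡ a × y ≡ b) ⊎ (x ≡ b × y ≡ a)

AssocTo : ℕ → Path × Label → Set
AssocTo n e = vertex (proj₂ e) ≡ n

assocTo? : ∀ n → Decidable (AssocTo n)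
assocTo? n e = vertex (proj₂ e) ℕ.≟ n

AssocNoLeft : ℕ → Path × Label → Set
AssocNoLeft n e = vertex (proj₂ e) ≡ n × left (proj₂ e) ≡ false

assocNoLeft? : ∀ n → Decidable (AssocNoLeft n)
assocNoLeft? n e = (vertex (proj₂ e) ℕ.≟ n) ×-dec (left (proj₂ e) Bool.≟ false)

EdgePair-swap : ∀ {T a b p} → EdgePair T a b p → EdgePair T b a p
EdgePair-swap (x∈ , y∈ , inj₁ ends , rest) = x∈ , y∈ , inj₂ ends , rest
EdgePair-swap (x∈ , y∈ , inj₂ ends , rest) = x∈ , y∈ , inj₁ ends , rest

record Invariant (A : List ℕ) (G : IGraph) (T : Tree) : Set where
  field
    node-vertex : ∀ {e} → e ∈ nodes T →
                  ∃ λ u → u ∈ verts G × name u ≡ vertex (proj₂ e) × col u ≡ colour (proj₂ e)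
    node-Xs⊆A   : ∀ {e x} → e ∈ nodes T → x ∈ Xs (proj₂ e) → x ∈ A
    first-segment : ∀ {k u} → IsFirstSegment G k → u ∈ verts G → MeetsSegment u k →
                    countAssoc (name u) T ≡ 1 ×
                    (∀ {e} → e ∈ nodes T → vertex (proj₂ e) ≡ name u → All (_≡ 0) (proj₁ e))
    last-segment  : ∀ {k u} → IsLastSegment G k → u ∈ verts G → MeetsSegment u k →
                    countAssoc (name u) T ≤ length A
    count-bound   : ∀ {u} → u ∈ verts G → countAssoc (name u) T ≤ suc (length A)
    count-noLeft  : ∀ {u} → u ∈ verts G → countAssocNoLeft (name u) T ≡ 1
    edgePair-sound  : ∀ {a b p} → EdgePair T a b p → adj G a b ≡ true
    edgePair-exists : ∀ {u w} → u ∈ verts G → w ∈ verts G → adj G (name u) (name w) ≡ true →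
                      ∃ (EdgePair T (name u) (name w))
    edgePair-unique : ∀ {a b p q} → EdgePair T a b p → EdgePair T a b q → p ≡ q

  node-name : ∀ {e} → e ∈ nodes T → NameIn (verts G) (vertex (proj₂ e))
  node-name e∈ = let (u , u∈ , eq , _) = node-vertex e∈ in u , u∈ , eq

  countAssoc-∉ : ∀ {n} → ¬ NameIn (verts G) n → countAssoc n T ≡ 0
  countAssoc-∉ n∉ =
    length-filter-none (assocTo? _) (nodes T) λ e∈ eq → n∉ (subst (NameIn _) eq (node-name e∈))

  countAssocNoLeft-∉ : ∀ {n} → ¬ NameIn (verts G) n → countAssocNoLeft n T ≡ 0
  countAssocNoLeft-∉ n∉ =
    length-filter-none (assocNoLeft? _) (nodes T) λ e∈ (eq , _) → n∉ (subst (NameIn _) eq (node-name e∈))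

  edgePair-names : ∀ {a b p} → EdgePair T a b p → NameIn (verts G) a × NameIn (verts G) b
  edgePair-names (x∈ , y∈ , inj₁ (refl , refl) , _) = node-name x∈ , node-name y∈
  edgePair-names (x∈ , y∈ , inj₂ (refl , refl) , _) = node-name y∈ , node-name x∈

invariant-empty : ∀ {A G} → verts G ≡ [] → Invariant A G []
invariant-empty {G = G} no-verts = record
  { node-vertex = λ ()
  ; node-Xs⊆A = λ ()
  ; first-segment = λ _ u∈ _ → ⊥-elim (∉G u∈)
  ; last-segment = λ _ u∈ _ → ⊥-elim (∉G u∈)
  ; count-bound = ⊥-elim ∘ ∉G
  ; count-noLeft = ⊥-elim ∘ ∉G
  ; edgePair-sound = λ { {p = _ , _} (() , _) }
  ; edgePair-exists = λ u∈ _ _ → ⊥-elim (∉G u∈)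
  ; edgePair-unique = λ { {p = _ , _} (() , _) }
  }
  where
  ∉G : ∀ {u} → ¬ u ∈ verts G
  ∉G u∈ = case subst (_ ∈_) no-verts u∈ of λ ()

module Step {A : List ℕ} {G : IGraph} (uA : Unique A) (ig : IsAIntervalGraph A G)
  {v : Vtx} {k : ℤ} (v∈ : v ∈ verts G) (first : IsFirstSegment G k) (v-meets : MeetsSegment v k)
  (longest : ∀ {u} → u ∈ verts G → MeetsSegment u k → intervalLength u ℤ.≤ intervalLength v)
  {T′ T″ : Tree} (I′ : Invariant (without (col v) A) (G′ v G) T′) (I″ : Invariant A (G″ v G) T″) where

  open IsAIntervalGraph ig
  open Chosen ig v∈ first v-meets longest
  module I′ = Invariant I′
  module I″ = Invariant I″
  open StepTree (lbl (col v) [] false false (name v)) (mod′ v G) (mod″ v G) T′ T″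

  A′ : List ℕ
  A′ = without (col v) A

  |A|≡1+|A′| : length A ≡ suc (length A′)
  |A|≡1+|A′| = length-without A uA (colour-in-A v∈)

  ≤|A′|⇒≤|A| : ∀ {n} → n ≤ length A′ → n ≤ length A
  ≤|A′|⇒≤|A| n≤ = subst (_ ≤_) (sym |A|≡1+|A′|) (ℕP.m≤n⇒m≤1+n n≤)

  countAssoc-v : countAssoc (name v) T ≡ 1
  countAssoc-v = trans (length-filter-nodes (assocTo? (name v)))
    (cong₂ _+_ (cong length (filter-accept (assocTo? (name v)) refl))
               (cong₂ _+_ (I′.countAssoc-∉ v∉G′) (I″.countAssoc-∉ v∉G″)))

  countAssoc-≢v : ∀ {n} → n ≢ name v → countAssoc n T ≡ countAssoc n T′ + countAssoc n T″
  countAssoc-≢v {n} n≢v = trans (length-filter-nodes (assocTo? n))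
    (cong (_+ (countAssoc n T′ + countAssoc n T″))
          (cong length (filter-reject (assocTo? n) (n≢v ∘ sym))))

  countAssoc-within : ∀ {u} → u ∈ verts G → name u ≢ name v → hi u ℤ.≤ hi v →
                      countAssoc (name u) T ≡ countAssoc (name u) T′
  countAssoc-within {u} u∈ u≢v hu≤hv = trans (countAssoc-≢v u≢v)
    (trans (cong (countAssoc (name u) T′ +_) (I″.countAssoc-∉ (within⇒∉G″ u∈ hu≤hv)))
           (ℕP.+-identityʳ _))

  countAssoc-beyond : ∀ {u} → u ∈ verts G → name u ≢ name v → ¬ Intersect u v →
                      countAssoc (name u) T ≡ countAssoc (name u) T″
  countAssoc-beyond {u} u∈ u≢v disj =
    trans (countAssoc-≢v u≢v)
          (cong (_+ countAssoc (name u) T″) (I′.countAssoc-∉ (disjoint⇒∉G′ u∈ disj)))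

  countAssoc-across : ∀ {u} → u ∈ verts G → name u ≢ name v → Intersect u v → hi v ℤ.< hi u →
                      countAssoc (name u) T ≤ length A
  countAssoc-across {u} u∈ u≢v i hv<hu = begin
    countAssoc (name u) T
      ≡⟨ countAssoc-≢v u≢v ⟩
    countAssoc (name u) T′ + countAssoc (name u) T″
      ≡⟨ cong (countAssoc (name u) T′ +_) (proj₁ (I″.first-segment first″ u″∈ meets″)) ⟩
    countAssoc (name u) T′ + 1
      ≤⟨ ℕP.+-monoˡ-≤ 1 (I′.last-segment last′ u′∈ meets′) ⟩
    length A′ + 1
      ≡⟨ ℕP.+-comm (length A′) 1 ⟩
    suc (length A′)
      ≡⟨ sym |A|≡1+|A′| ⟩
    length A ∎
    where
    open ℕP.≤-Reasoning
    u′∈ = ∈G′⁺ u∈ u≢v i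
    u″∈ = ∈G″⁺ u∈ hv<hu
    last′ = proj₁ (G′-last u∈ u≢v i (ℤP.<⇒≤ hv<hu))
    meets′ = proj₂ (G′-last u∈ u≢v i (ℤP.<⇒≤ hv<hu))
    first″ = proj₁ (G″-first u∈ i hv<hu)
    meets″ = proj₂ (G″-first u∈ i hv<hu)

  first-segment : ∀ {k₁ u} → IsFirstSegment G k₁ → u ∈ verts G → MeetsSegment u k₁ →
                  countAssoc (name u) T ≡ 1 ×
                  (∀ {e} → e ∈ nodes T → vertex (proj₂ e) ≡ name u → All (_≡ 0) (proj₁ e))
  first-segment {u = u} first₁ u∈ u-meets with first-segment-unique first₁ | name u ℕ.≟ name v
  ... | refl | yes u≡v with name-injective u∈ v∈ u≡v
  ...   | refl = countAssoc-v , zero-path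
    where
    zero-path : ∀ {e} → e ∈ nodes T → vertex (proj₂ e) ≡ name v → All (_≡ 0) (proj₁ e)
    zero-path e∈ e↦v with node-view e∈
    ... | root-node     = refl ∷ []
    ... | first-node x∈ = ⊥-elim (v∉G′ (subst (NameIn _) e↦v (I′.node-name x∈)))
    ... | rest-node x∈  = ⊥-elim (v∉G″ (subst (NameIn _) e↦v (I″.node-name x∈)))
  first-segment {u = u} first₁ u∈ u-meets | refl | no u≢v =
    trans (countAssoc-within u∈ u≢v hu≤hv) (proj₁ IH) , zero-path
    where
    hu≤hv = meets-first⇒hi≤hi-v u∈ u-meets
    IH = I′.first-segment (proj₁ (G′-first u∈ u-meets u≢v))
                          (∈G′⁺ u∈ u≢v (meets-first⇒intersects {u} u-meets))
                          (proj₂ (G′-first u∈ u-meets u≢v))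
    zero-path : ∀ {e} → e ∈ nodes T → vertex (proj₂ e) ≡ name u → All (_≡ 0) (proj₁ e)
    zero-path e∈ e↦u with node-view e∈
    ... | root-node     = refl ∷ []
    ... | first-node x∈ = refl ∷ proj₂ IH x∈ e↦u
    ... | rest-node x∈  = ⊥-elim (within⇒∉G″ u∈ hu≤hv (subst (NameIn _) e↦u (I″.node-name x∈)))

  last-segment : ∀ {k′ u} → IsLastSegment G k′ → u ∈ verts G → MeetsSegment u k′ →
                 countAssoc (name u) T ≤ length A
  last-segment {u = u} last u∈ u-meets with position u∈
  ... | chosen refl = subst (_≤ length A) (sym countAssoc-v) (subst (1 ≤_) (sym |A|≡1+|A′|) (s≤s z≤n))
  ... | within u≢v i hu≤hv = subst (_≤ length A) (sym (countAssoc-within u∈ u≢v hu≤hv))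
          (≤|A′|⇒≤|A| (I′.last-segment (proj₁ G′-last′) (∈G′⁺ u∈ u≢v i) (proj₂ G′-last′)))
    where G′-last′ = G′-last u∈ u≢v i (meets-last⇒hi-v≤hi {u = u} last u-meets)
  ... | beyond u≢v disj = subst (_≤ length A) (sym (countAssoc-beyond u∈ u≢v disj))
          (I″.last-segment (proj₁ G″-last′) (∈G″⁺ u∈ (disjoint⇒hi-v<hi u∈ disj)) (proj₂ G″-last′))
    where G″-last′ = G″-last last u∈ u-meets (disjoint⇒hi-v<hi u∈ disj)
  ... | across u≢v i hv<hu = countAssoc-across u∈ u≢v i hv<hu

  count-bound : ∀ {u} → u ∈ verts G → countAssoc (name u) T ≤ suc (length A)
  count-bound {u} u∈ with position u∈
  ... | chosen refl = subst (_≤ suc (length A)) (sym countAssoc-v) (s≤s z≤n)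
  ... | within u≢v i hu≤hv = subst (_≤ suc (length A)) (sym (countAssoc-within u∈ u≢v hu≤hv))
          (subst (countAssoc (name u) T′ ≤_) (cong suc (sym |A|≡1+|A′|))
                 (ℕP.m≤n⇒m≤1+n (I′.count-bound (∈G′⁺ u∈ u≢v i))))
  ... | beyond u≢v disj = subst (_≤ suc (length A)) (sym (countAssoc-beyond u∈ u≢v disj))
          (I″.count-bound (∈G″⁺ u∈ (disjoint⇒hi-v<hi u∈ disj)))
  ... | across u≢v i hv<hu = ℕP.m≤n⇒m≤1+n (countAssoc-across u∈ u≢v i hv<hu)

  left-mod″-inG′ : ∀ {x} → x ∈ nodes T″ → inG′ v G (vertex (proj₂ x)) ≡ true →
                   left (mod″ v G (proj₂ x)) ≡ true
  left-mod″-inG′ {x} x∈ inG′≡true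
    rewrite inG′≡true | any-name⁺ (verts (G″ v G)) (I″.node-name x∈) = ∨-zeroʳ (left (proj₂ x))

  left-mod″-∉G′ : ∀ l → inG′ v G (vertex l) ≡ false → left (mod″ v G l) ≡ left l
  left-mod″-∉G′ l inG′≡false rewrite inG′≡false = ∨-identityʳ (left l)

  countAssocNoLeft-split : ∀ n → countAssocNoLeft n T ≡
    length (filter (assocNoLeft? n) (root ∷ [])) +
    (countAssocNoLeft n T′ + length (filter (assocNoLeft? n ∘ liftRest (mod″ v G)) (nodes T″)))
  countAssocNoLeft-split n = length-filter-nodes (assocNoLeft? n)

  countAssocNoLeft-v : countAssocNoLeft (name v) T ≡ 1
  countAssocNoLeft-v = trans (countAssocNoLeft-split (name v))
    (cong₂ _+_ (cong length (filter-accept (assocNoLeft? (name v)) (refl , refl)))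
               (cong₂ _+_ (I′.countAssocNoLeft-∉ v∉G′) rest≡0))
    where
    rest≡0 : length (filter (assocNoLeft? (name v) ∘ liftRest (mod″ v G)) (nodes T″)) ≡ 0
    rest≡0 = length-filter-none _ (nodes T″)
      λ x∈ (x↦v , _) → v∉G″ (subst (NameIn _) x↦v (I″.node-name x∈))

  countAssocNoLeft-inG′ : ∀ {n} → NameIn (verts (G′ v G)) n → countAssocNoLeft n T ≡ countAssocNoLeft n T′
  countAssocNoLeft-inG′ {n} n∈G′ = trans (countAssocNoLeft-split n)
    (cong₂ _+_ (cong length (filter-reject (assocNoLeft? n) (nameInG′⇒≢v n∈G′ ∘ sym ∘ proj₁)))
               (trans (cong (countAssocNoLeft n T′ +_) rest≡0) (ℕP.+-identityʳ _)))
    where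
    rest≡0 : length (filter (assocNoLeft? n ∘ liftRest (mod″ v G)) (nodes T″)) ≡ 0
    rest≡0 = length-filter-none _ (nodes T″) λ {x} x∈ (x↦n , no-left) →
      case trans (sym no-left) (left-mod″-inG′ x∈ (subst (λ m → inG′ v G m ≡ true) (sym x↦n)
                                                         (any-name⁺ (verts (G′ v G)) n∈G′))) of λ ()

  countAssocNoLeft-∉G′ : ∀ {n} → n ≢ name v → ¬ NameIn (verts (G′ v G)) n →
                         countAssocNoLeft n T ≡ countAssocNoLeft n T″
  countAssocNoLeft-∉G′ {n} n≢v n∉G′ = trans (countAssocNoLeft-split n)
    (cong₂ _+_ (cong length (filter-reject (assocNoLeft? n) (n≢v ∘ sym ∘ proj₁)))
               (cong₂ _+_ (I′.countAssocNoLeft-∉ n∉G′) (cong length (filter-≐ _ _ same (nodes T″)))))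
    where
    inG′≡false : ∀ l → vertex l ≡ n → inG′ v G (vertex l) ≡ false
    inG′≡false l refl = any-name-∉ (verts (G′ v G)) n∉G′
    same : (AssocNoLeft n ∘ liftRest (mod″ v G)) ≐ AssocNoLeft n
    same = (λ {x} (x↦n , no-left) → x↦n , trans (sym (left≡ x x↦n)) no-left)
         , (λ {x} (x↦n , no-left) → x↦n , trans (left≡ x x↦n) no-left)
      where
      left≡ : ∀ x → vertex (proj₂ x) ≡ n → left (mod″ v G (proj₂ x)) ≡ left (proj₂ x)
      left≡ x x↦n = left-mod″-∉G′ (proj₂ x) (inG′≡false (proj₂ x) x↦n)

  countAssocNoLeft-intersecting : ∀ {u} → u ∈ verts G → name u ≢ name v → Intersect u v →
                                  countAssocNoLeft (name u) T ≡ 1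
  countAssocNoLeft-intersecting u∈ u≢v i =
    trans (countAssocNoLeft-inG′ (nameInG′⁺ u∈ u≢v i)) (I′.count-noLeft (∈G′⁺ u∈ u≢v i))

  count-noLeft : ∀ {u} → u ∈ verts G → countAssocNoLeft (name u) T ≡ 1
  count-noLeft u∈ with position u∈
  ... | chosen refl = countAssocNoLeft-v
  ... | within u≢v i _ = countAssocNoLeft-intersecting u∈ u≢v i
  ... | across u≢v i _ = countAssocNoLeft-intersecting u∈ u≢v i
  ... | beyond u≢v disj = trans (countAssocNoLeft-∉G′ u≢v (disjoint⇒∉G′ u∈ disj))
                                (I″.count-noLeft (∈G″⁺ u∈ (disjoint⇒hi-v<hi u∈ disj)))

  node-vertex : ∀ {e} → e ∈ nodes T →
                ∃ λ u → u ∈ verts G × name u ≡ vertex (proj₂ e) × col u ≡ colour (proj₂ e)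
  node-vertex e∈ with node-view e∈
  ... | root-node = v , v∈ , refl , refl
  ... | first-node x∈ with I′.node-vertex x∈
  ...   | u′ , u′∈ , n≡ , c≡ with ∈G′⁻ u′∈
  ...     | u , u∈ , _ , _ , refl = u , u∈ , n≡ , c≡
  node-vertex e∈ | rest-node x∈ with I″.node-vertex x∈
  ...   | u″ , u″∈ , n≡ , c≡ with ∈G″⁻ u″∈
  ...     | u , u∈ , _ , refl = u , u∈ , n≡ , c≡

  Xs-mod′⁻ : ∀ l {c} → c ∈ Xs (mod′ v G l) → c ≡ col v ⊎ c ∈ Xs l
  Xs-mod′⁻ l c∈ with adj G (name v) (vertex l) ∧ not (left l)
  Xs-mod′⁻ l (here refl) | true  = inj₁ refl
  Xs-mod′⁻ l (there c∈)  | true  = inj₂ c∈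
  Xs-mod′⁻ l c∈          | false = inj₂ c∈

  Xs-mod′⁺ : ∀ l {c} → c ∈ Xs l → c ∈ Xs (mod′ v G l)
  Xs-mod′⁺ l c∈ with adj G (name v) (vertex l) ∧ not (left l)
  ... | true  = there c∈
  ... | false = c∈

  col-v∈Xs-mod′ : ∀ l → adj G (name v) (vertex l) ≡ true → left l ≡ false → col v ∈ Xs (mod′ v G l)
  col-v∈Xs-mod′ l adj≡true left≡false rewrite adj≡true | left≡false = here refl

  -- col v ∉ A′ ⊇ Xs l, so col v can only have been added by mod′.
  col-v∈Xs-mod′⁻ : ∀ {x} → x ∈ nodes T′ → col v ∈ Xs (mod′ v G (proj₂ x)) →
                   adj G (name v) (vertex (proj₂ x)) ≡ true × left (proj₂ x) ≡ false
  col-v∈Xs-mod′⁻ {x} x∈ c∈ with adj G (name v) (vertex (proj₂ x)) | left (proj₂ x)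
  ... | true  | false = refl , refl
  ... | true  | true  = ⊥-elim (c∉without (col v) A (I′.node-Xs⊆A x∈ c∈))
  ... | false | _     = ⊥-elim (c∉without (col v) A (I′.node-Xs⊆A x∈ c∈))

  node-Xs⊆A : ∀ {e c} → e ∈ nodes T → c ∈ Xs (proj₂ e) → c ∈ A
  node-Xs⊆A e∈ c∈ with node-view e∈
  node-Xs⊆A e∈ () | root-node
  ... | rest-node x∈ = I″.node-Xs⊆A x∈ c∈
  ... | first-node {x} x∈ with Xs-mod′⁻ (proj₂ x) c∈
  ...   | inj₁ refl = colour-in-A v∈
  ...   | inj₂ c∈′  = without-⊆ A (I′.node-Xs⊆A x∈ c∈′)

  colour-T′ : ∀ {z} → z ∈ nodes T′ → colour (proj₂ z) ∈ A′
  colour-T′ z∈ with I′.node-vertex z∈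
  ... | u′ , u′∈ , _ , refl = IsAIntervalGraph.colour-in-A (G′-isAIntervalGraph ig v∈) u′∈

  data EdgePairView (a b : ℕ) : (Path × Label) × (Path × Label) → Set where
    toRoot : ∀ {z} → z ∈ nodes T′ → adj G (name v) (vertex (proj₂ z)) ≡ true → left (proj₂ z) ≡ false →
             Endpoints a b (vertex (proj₂ z)) (name v) → EdgePairView a b (liftFirst (mod′ v G) z , root)
    inT′   : ∀ {z z′} → EdgePair T′ a b (z , z′) →
             EdgePairView a b (liftFirst (mod′ v G) z , liftFirst (mod′ v G) z′)
    inT″   : ∀ {z z′} → EdgePair T″ a b (z , z′) →
             EdgePairView a b (liftRest (mod″ v G) z , liftRest (mod″ v G) z′)

  edgePair-view : ∀ {a b p} → EdgePair T a b p → EdgePairView a b p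
  edgePair-view (x∈ , y∈ , ends , y≼x , cy∈Xs) with node-view x∈ | node-view y∈
  ... | root-node     | _              = case cy∈Xs of λ ()
  ... | first-node z∈ | root-node      =
    let (adj≡true , left≡false) = col-v∈Xs-mod′⁻ z∈ cy∈Xs in toRoot z∈ adj≡true left≡false ends
  ... | first-node _  | rest-node z′∈  = ⊥-elim (¬rest≼first z′∈ y≼x)
  ... | rest-node z∈  | root-node      = ⊥-elim (¬first≼rest z∈ y≼x)
  ... | rest-node z∈  | first-node _   = ⊥-elim (¬first≼rest z∈ y≼x)
  ... | rest-node z∈  | rest-node z′∈  = inT″ (z∈ , z′∈ , ends , Prefix-bump⁻ y≼x , cy∈Xs)
  ... | first-node {z} z∈ | first-node z′∈ with Xs-mod′⁻ (proj₂ z) cy∈Xs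
  ...   | inj₁ c≡col-v = ⊥-elim (c∉without (col v) A (subst (_∈ A′) c≡col-v (colour-T′ z′∈)))
  ...   | inj₂ c∈      = inT′ (z∈ , z′∈ , ends , tail y≼x , c∈)

  adj-to-v : ∀ {n} → NameIn (verts G) n → adj G (name v) n ≡ true → adj G n (name v) ≡ true
  adj-to-v (u , u∈ , refl) adj≡true = trans (adj-sym u∈ v∈) adj≡true

  edgePair-sound : ∀ {a b p} → EdgePair T a b p → adj G a b ≡ true
  edgePair-sound ep with edgePair-view ep
  ... | toRoot z∈ adj≡true _ (inj₁ (refl , refl)) = adj-to-v (nameInG′⇒inG (I′.node-name z∈)) adj≡true
  ... | toRoot z∈ adj≡true _ (inj₂ (refl , refl)) = adj≡true
  ... | inT′ ep′ = I′.edgePair-sound ep′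
  ... | inT″ ep″ = proj₁ (∧≡true⇒ (I″.edgePair-sound ep″))

  v-endpoint : ∀ {P : ℕ → Set} {a b n} → Endpoints a b n (name v) → P a × P b → P (name v)
  v-endpoint (inj₁ (_ , refl)) (_ , Pb) = Pb
  v-endpoint (inj₂ (_ , refl)) (Pa , _) = Pa

  other-endpoint : ∀ {a b x y n} → x ≢ n → Endpoints a b x n → Endpoints a b y n → x ≡ y
  other-endpoint _   (inj₁ (refl , _))    (inj₁ (refl , _))   = refl
  other-endpoint _   (inj₂ (refl , _))    (inj₂ (refl , _))   = refl
  other-endpoint x≢n (inj₁ (x≡a , _))    (inj₂ (_ , n≡a))    = contradiction (trans x≡a (sym n≡a)) x≢n
  other-endpoint x≢n (inj₂ (x≡b , _))    (inj₁ (_ , n≡b))    = contradiction (trans x≡b (sym n≡b)) x≢n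

  same-toRoot : ∀ {a b z z′} → z ∈ nodes T′ → z′ ∈ nodes T′ →
                left (proj₂ z) ≡ false → left (proj₂ z′) ≡ false →
                Endpoints a b (vertex (proj₂ z)) (name v) → Endpoints a b (vertex (proj₂ z′)) (name v) →
                z ≡ z′
  same-toRoot {z = z} z∈ z′∈ z-left z′-left ends ends′ with I′.node-vertex z∈
  ... | u′ , u′∈ , u′↦z , _ =
    length-filter≡1⇒≡ (assocNoLeft? _) (nodes T′)
      (subst (λ n → countAssocNoLeft n T′ ≡ 1) u′↦z (I′.count-noLeft u′∈))
      z∈ (refl , z-left) z′∈ (sym z≡z′ , z′-left)
    where
    z≡z′ = other-endpoint (nameInG′⇒≢v (I′.node-name z∈)) ends ends′

  ¬inT′×inT″ : ∀ {a b p q} → EdgePair T′ a b p → EdgePair T″ a b q → ⊥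
  ¬inT′×inT″ ep′ ep″ with I′.edgePair-names ep′
  ... | a∈G′ , b∈G′ = case trans (sym both-inG′) (proj₂ (∧≡true⇒ (I″.edgePair-sound ep″))) of λ ()
    where
    both-inG′ = cong₂ (λ x y → not (x ∧ y))
                      (any-name⁺ (verts (G′ v G)) a∈G′) (any-name⁺ (verts (G′ v G)) b∈G′)

  edgePair-unique : ∀ {a b p q} → EdgePair T a b p → EdgePair T a b q → p ≡ q
  edgePair-unique ep eq with edgePair-view ep | edgePair-view eq
  ... | toRoot z∈ _ z-left ends | toRoot z′∈ _ z′-left ends′ =
    cong (λ z → liftFirst (mod′ v G) z , root) (same-toRoot z∈ z′∈ z-left z′-left ends ends′)
  ... | toRoot _ _ _ ends | inT′ ep′ = ⊥-elim (v∉G′ (v-endpoint ends (I′.edgePair-names ep′)))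
  ... | toRoot _ _ _ ends | inT″ ep″ = ⊥-elim (v∉G″ (v-endpoint ends (I″.edgePair-names ep″)))
  ... | inT′ ep′ | toRoot _ _ _ ends = ⊥-elim (v∉G′ (v-endpoint ends (I′.edgePair-names ep′)))
  ... | inT″ ep″ | toRoot _ _ _ ends = ⊥-elim (v∉G″ (v-endpoint ends (I″.edgePair-names ep″)))
  ... | inT′ ep′ | inT″ ep″ = ⊥-elim (¬inT′×inT″ ep′ ep″)
  ... | inT″ ep″ | inT′ ep′ = ⊥-elim (¬inT′×inT″ ep′ ep″)
  ... | inT′ ep₁ | inT′ ep₂ =
    cong (Product.map (liftFirst (mod′ v G)) (liftFirst (mod′ v G))) (I′.edgePair-unique ep₁ ep₂)
  ... | inT″ ep₁ | inT″ ep₂ =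
    cong (Product.map (liftRest (mod″ v G)) (liftRest (mod″ v G))) (I″.edgePair-unique ep₁ ep₂)

  liftFirst-edgePair : ∀ {a b z z′} → EdgePair T′ a b (z , z′) →
                       EdgePair T a b (liftFirst (mod′ v G) z , liftFirst (mod′ v G) z′)
  liftFirst-edgePair {z = z} (z∈ , z′∈ , ends , z′≼z , c∈) =
    liftFirst∈nodes z∈ , liftFirst∈nodes z′∈ , ends , refl ∷ z′≼z , Xs-mod′⁺ (proj₂ z) c∈

  liftRest-edgePair : ∀ {a b z z′} → EdgePair T″ a b (z , z′) →
                      EdgePair T a b (liftRest (mod″ v G) z , liftRest (mod″ v G) z′)
  liftRest-edgePair (z∈ , z′∈ , ends , z′≼z , c∈) =
    liftRest∈nodes z∈ , liftRest∈nodes z′∈ , ends , Prefix-bump⁺ z′≼z , c∈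

  -- The unique copy of w in T′ without ← receives col v.
  edgePair-from-v : ∀ {w} → w ∈ verts G → adj G (name v) (name w) ≡ true →
                    ∃ (EdgePair T (name v) (name w))
  edgePair-from-v {w} w∈ adj≡true
    with length-filter≡1⇒∃ (assocNoLeft? (name w)) (nodes T′) (I′.count-noLeft (∈G′⁺ w∈ w≢v w∩v))
    where
    w≢v : name w ≢ name v
    w≢v w≡v with name-injective w∈ v∈ w≡v
    ... | refl = case trans (sym adj≡true) (adj-irrefl v∈) of λ ()
    w∩v : Intersect w v
    w∩v = let (lv<hw , lw<hv) = adj⇒intersect v∈ w∈ adj≡true in lw<hv , lv<hw
  ... | z , z∈ , z↦w , z-left =
    (liftFirst (mod′ v G) z , root) ,
    liftFirst∈nodes z∈ , root∈nodes , inj₂ (z↦w , refl) , refl ∷ [] ,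
    col-v∈Xs-mod′ (proj₂ z) (subst (λ n → adj G (name v) n ≡ true) (sym z↦w) adj≡true) z-left

  edgePair-avoiding-v : ∀ {u w} → u ∈ verts G → w ∈ verts G → name u ≢ name v → name w ≢ name v →
                        adj G (name u) (name w) ≡ true → ∃ (EdgePair T (name u) (name w))
  edgePair-avoiding-v {u} {w} u∈ w∈ u≢v w≢v adj≡true with intersect? u v | intersect? w v
  ... | yes u∩v | yes w∩v =
    let (_ , ep′) = I′.edgePair-exists (∈G′⁺ u∈ u≢v u∩v) (∈G′⁺ w∈ w≢v w∩v) adj≡true
    in _ , liftFirst-edgePair ep′
  ... | no u∤v | _ =
    let (_ , ep″) = I″.edgePair-exists (∈G″⁺ u∈ hv<hu) (∈G″⁺ w∈ hv<hw) adj″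
    in _ , liftRest-edgePair ep″
    where
    hv<hu = disjoint⇒hi-v<hi u∈ u∤v
    hv<hw = ℤP.≤-<-trans (disjoint⇒hi-v≤lo u∈ u∤v) (proj₁ (adj⇒intersect u∈ w∈ adj≡true))
    adj″ : adj (G″ v G) (name u) (name w) ≡ true
    adj″ rewrite adj≡true | any-name-∉ (verts (G′ v G)) (disjoint⇒∉G′ u∈ u∤v) = refl
  ... | yes _ | no w∤v =
    let (_ , ep″) = I″.edgePair-exists (∈G″⁺ u∈ hv<hu) (∈G″⁺ w∈ hv<hw) adj″
    in _ , liftRest-edgePair ep″
    where
    hv<hw = disjoint⇒hi-v<hi w∈ w∤v
    hv<hu = ℤP.≤-<-trans (disjoint⇒hi-v≤lo w∈ w∤v) (proj₂ (adj⇒intersect u∈ w∈ adj≡true))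
    adj″ : adj (G″ v G) (name u) (name w) ≡ true
    adj″ rewrite adj≡true | any-name-∉ (verts (G′ v G)) (disjoint⇒∉G′ w∈ w∤v)
               | ∧-zeroʳ (inG′ v G (name u)) = refl

  edgePair-exists : ∀ {u w} → u ∈ verts G → w ∈ verts G → adj G (name u) (name w) ≡ true →
                    ∃ (EdgePair T (name u) (name w))
  edgePair-exists {u} {w} u∈ w∈ adj≡true with name u ℕ.≟ name v | name w ℕ.≟ name v
  ... | yes u≡v | _ with name-injective u∈ v∈ u≡v
  ...   | refl = edgePair-from-v w∈ adj≡true
  edgePair-exists {u} {w} u∈ w∈ adj≡true | no _ | yes w≡v with name-injective w∈ v∈ w≡v
  ...   | refl =
    let (p , ep) = edgePair-from-v u∈ (trans (adj-sym v∈ u∈) adj≡true) in p , EdgePair-swap {T} ep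
  edgePair-exists u∈ w∈ adj≡true | no u≢v | no w≢v = edgePair-avoiding-v u∈ w∈ u≢v w≢v adj≡true

  invariant : Invariant A G T
  invariant = record
    { node-vertex = node-vertex
    ; node-Xs⊆A = node-Xs⊆A
    ; first-segment = first-segment
    ; last-segment = last-segment
    ; count-bound = count-bound
    ; count-noLeft = count-noLeft
    ; edgePair-sound = edgePair-sound
    ; edgePair-exists = edgePair-exists
    ; edgePair-unique = edgePair-unique
    }

invariant : ∀ {A G T} → IsT A G T → Unique A → IsAIntervalGraph A G → Invariant A G T
invariant (empty no-verts) _ _ = invariant-empty no-verts
invariant (step v k v∈ first v-meets longest t′ t″) uA ig =
  Step.invariant uA ig v∈ first v-meets longest
    (invariant t′ (Unique-keep _ uA) (G′-isAIntervalGraph ig v∈))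
    (invariant t″ uA (G″-isAIntervalGraph ig v∈))

lemma12 : (A : List ℕ) → Unique A → (G : IGraph) → IsAIntervalGraph A G →
          (T : Tree) → IsT A G T →
          (∀ {k u} → IsFirstSegment G k → u ∈ verts G → MeetsSegment u k →
             countAssoc (name u) T ≡ 1 ×
             (∀ {e} → e ∈ nodes T → vertex (proj₂ e) ≡ name u → All (_≡ 0) (proj₁ e)))
          × (∀ {k u} → IsLastSegment G k → u ∈ verts G → MeetsSegment u k →
             countAssoc (name u) T ≤ length A)
          × (∀ {u} → u ∈ verts G → countAssoc (name u) T ≤ suc (length A))
          × (∀ {u} → u ∈ verts G → countAssocNoLeft (name u) T ≡ 1)
          × (∀ {u w} → u ∈ verts G → w ∈ verts G → adj G (name u) (name w) ≡ true →
             ∃! _≡_ (EdgePair T (name u) (name w)))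
lemma12 A uA G ig T t =
  first-segment , last-segment , count-bound , count-noLeft ,
  λ u∈ w∈ adj≡true → let (p , ep) = edgePair-exists u∈ w∈ adj≡true in p , ep , edgePair-unique ep
  where open Invariant (invariant t uA ig)
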